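{- For all sufficiently large integers $w\geq0$, if $p\geq p_w$ is an integer then $|V(G_{w,p})|\leq5\cdot2^{p}$.
   Context: For integers $w,p\geq0$ define $\alpha(w,p)=\frac{1}{1+(2/3)^{w}}\Big(\frac{2+(2/3)^{w}}{1+(2/3)^{w}}\Big)^{p-1}$, $\beta(w)=3(\frac{3}{2})^{w}$ and $\delta(w)=(2+(\frac{2}{3})^{w})\beta(w)$. Let $p_w$ be the smallest integer such that $\alpha(w,p_w+1)\geq\beta(w)$. For $p\geq p_w$ define $G_{w,p}$ recursively: $G_{w,p_w}$ is the complete graph $K_{\lceil\delta(w)\rceil}$, and for $p\geq p_w+1$, $G_{w,p}$ is obtained from a complete graph $K_{w+1}$ and two disjoint copies of $G_{w,p-1}$ by adding all edges between the vertices of $K_{w+1}$ and the vertices of the two copies. -}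

module Defs where

open import Data.Nat as ℕ using (ℕ; zero; suc)
open import Data.Integer as ℤ using (ℤ; +_)
open import Data.Rational as ℚ using (ℚ; 0ℚ; 1ℚ; _+_; _*_; _÷_; _≤_; _/_; ≢-nonZero)
open import Data.Rational.Properties using (_≟_)
open import Data.Fin as Fin using (Fin; splitAt)
import Data.Fin.Properties as FinP
open import Data.Bool using (Bool; true; false; not)
open import Data.Sum using (_⊎_; inj₁; inj₂)
open import Relation.Nullary using (yes; no; ¬_; does)

_^ℚ_ : ℚ → ℕ → ℚ
q ^ℚ zero  = 1ℚ
q ^ℚ suc n = q * (q ^ℚ n)

-- division of rationals (totalised: dividing by 0 gives 0; it is only
-- ever applied below to strictly positive denominators)
_/ℚ_ : ℚ → ℚ → ℚ
p /ℚ q with q ≟ 0ℚ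
... | yes _ = 0ℚ
... | no q≢0 = _÷_ p q {{≢-nonZero q≢0}}

x : ℕ → ℚ
x w = ((+ 2) / 3) ^ℚ w

-- α(w,p) = 1/(1+(2/3)^w) * ((2+(2/3)^w)/(1+(2/3)^w))^(p-1),  for p ≥ 1.
-- Only used with p ≥ 1, so we index by q = p - 1:  αsuc w q = α(w, q+1).
αsuc : ℕ → ℕ → ℚ
αsuc w q = (1ℚ /ℚ (1ℚ + x w)) * ((((+ 2) / 1 + x w) /ℚ (1ℚ + x w)) ^ℚ q)

β : ℕ → ℚ
β w = ((+ 3) / 1) * (((+ 3) / 2) ^ℚ w)

δ : ℕ → ℚ
δ w = ((+ 2) / 1 + x w) * β w

-- ⌈δ(w)⌉ as a natural number (δ(w) > 0)
ceilδ : ℕ → ℕ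
ceilδ w = ℤ.∣ ℚ.ceiling (δ w) ∣

IsPw : ℕ → ℕ → Set
IsPw w p = (β w ≤ αsuc w p) × (∀ q → q ℕ.< p → ¬ (β w ≤ αsuc w q))
  where open import Data.Product using (_×_)

record Graph : Set where
  field
    n   : ℕ
    adj : Fin n → Fin n → Bool

open Graph public

∣V∣ : Graph → ℕ
∣V∣ G = n G

K : ℕ → Graph
K m = record { n = m ; adj = λ i j → not (does (i FinP.≟ j)) }

-- vertices of K_{a} + (copy 1 of G) + (copy 2 of G)
classify : ∀ a m → Fin (a ℕ.+ (m ℕ.+ m)) → Fin a ⊎ (Fin m ⊎ Fin m)
classify a m i with splitAt a i
... | inj₁ k = inj₁ k
... | inj₂ j = inj₂ (splitAt m j)

joinAdj : ∀ a (G : Graph) → Fin a ⊎ (Fin (n G) ⊎ Fin (n G))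
        → Fin a ⊎ (Fin (n G) ⊎ Fin (n G)) → Bool
joinAdj a G (inj₁ k) (inj₁ l) = not (does (k FinP.≟ l))
joinAdj a G (inj₁ _) (inj₂ _) = true
joinAdj a G (inj₂ _) (inj₁ _) = true
joinAdj a G (inj₂ (inj₁ u)) (inj₂ (inj₁ v)) = adj G u v
joinAdj a G (inj₂ (inj₂ u)) (inj₂ (inj₂ v)) = adj G u v
joinAdj a G (inj₂ (inj₁ _)) (inj₂ (inj₂ _)) = false
joinAdj a G (inj₂ (inj₂ _)) (inj₂ (inj₁ _)) = false

step : ℕ → Graph → Graph
step a G = record
  { n   = a ℕ.+ (n G ℕ.+ n G)
  ; adj = λ i j → joinAdj a G (classify a (n G) i) (classify a (n G) j) }

-- Gfrom w k = G_{w, p_w + k}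
Gfrom : ℕ → ℕ → Graph
Gfrom w zero    = K (ceilδ w)
Gfrom w (suc k) = step (suc w) (Gfrom w k)

G : (w pw p : ℕ) → Graph
G w pw p = Gfrom w (p ℕ.∸ pw)

module Submission where

-- Every step of the recursion doubles |V| + (w + 1), so
-- |V(G_{w,p})| + w + 1 = 2^(p - p_w) (⌈δ(w)⌉ + w + 1), and it suffices to show
-- ⌈δ(w)⌉ ≤ 3·2^p_w and w + 1 ≤ 2·2^p_w.  With x = (2/3)^w ∈ [0,1] we have
-- 1/(1+x) ≤ 1 and (2+x)/(1+x) ≤ 2, hence β(w) ≤ α(w, p_w + 1) ≤ 2^p_w; then
-- δ(w) = (2+x) β(w) ≤ 3β(w), while w + 1 ≤ 2β(w) since β grows by the factor 3/2.
-- Only the defining inequality of p_w is used (not its minimality), and the bound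
-- holds for every w, so W = 0.

open import Defs

open import Data.Integer as ℤ using (+_; 0ℤ)
import Data.Integer.DivMod as ℤ
import Data.Integer.Properties as ℤ
import Data.Integer.Solver as ℤ-Solver
open import Data.Nat as ℕ using (ℕ; zero; suc)
import Data.Nat.Properties as ℕ
import Data.Nat.Solver as ℕ-Solver
open import Data.Product using (Σ; _,_; proj₁)
open import Data.Rational as ℚ using (ℚ; mkℚ; 0ℚ; 1ℚ; _+_; _*_; _≤_; -_; 1/_; floor; ceiling; Positive)
open import Data.Rational.Literals using (fromℤ)
open import Data.Rational.Properties as ℚ using (≤-refl; ≤-trans)
import Data.Rational.Solver as ℚ-Solver
open import Data.Rational.Unnormalised.Base using (*≡*)
import Data.Rational.Unnormalised.Properties as ℚᵘ
open import Relation.Binary.PropositionalEquality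
open import Relation.Nullary using (yes; no; contradiction)

fromℤ-+ : ∀ i j → fromℤ (i ℤ.+ j) ≡ fromℤ i + fromℤ j
fromℤ-+ i j = ℚ.toℚᵘ-injective (ℚᵘ.≃-sym (ℚᵘ.≃-trans (ℚ.toℚᵘ-homo-+ (fromℤ i) (fromℤ j)) (*≡* eq)))
  where
  open ℤ-Solver.+-*-Solver
  eq : (i ℤ.* ℤ.1ℤ ℤ.+ j ℤ.* ℤ.1ℤ) ℤ.* ℤ.1ℤ ≡ (i ℤ.+ j) ℤ.* (ℤ.1ℤ ℤ.* ℤ.1ℤ)
  eq = solve 2 (λ a b → (a :* con ℤ.1ℤ :+ b :* con ℤ.1ℤ) :* con ℤ.1ℤ := (a :+ b) :* (con ℤ.1ℤ :* con ℤ.1ℤ)) refl i j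

fromℤ-* : ∀ i j → fromℤ (i ℤ.* j) ≡ fromℤ i * fromℤ j
fromℤ-* i j = ℚ.toℚᵘ-injective (ℚᵘ.≃-sym (ℚᵘ.≃-trans (ℚ.toℚᵘ-homo-* (fromℤ i) (fromℤ j)) (*≡* refl)))

fromℕ : ℕ → ℚ
fromℕ n = fromℤ (+ n)

fromℕ-+ : ∀ m n → fromℕ (m ℕ.+ n) ≡ fromℕ m + fromℕ n
fromℕ-+ m n = trans (cong fromℤ (ℤ.pos-+ m n)) (fromℤ-+ (+ m) (+ n))

fromℕ-* : ∀ m n → fromℕ (m ℕ.* n) ≡ fromℕ m * fromℕ n
fromℕ-* m n = trans (cong fromℤ (ℤ.pos-* m n)) (fromℤ-* (+ m) (+ n))

fromℕ-^ : ∀ m k → fromℕ m ^ℚ k ≡ fromℕ (m ℕ.^ k)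
fromℕ-^ m zero    = refl
fromℕ-^ m (suc k) = trans (cong (fromℕ m *_) (fromℕ-^ m k)) (sym (fromℕ-* m (m ℕ.^ k)))

fromℕ-cancel-≤ : ∀ {m n} → fromℕ m ≤ fromℕ n → m ℕ.≤ n
fromℕ-cancel-≤ {m} {n} (ℚ.*≤* m≤n) = ℤ.drop‿+≤+ (subst₂ ℤ._≤_ (ℤ.*-identityʳ (+ m)) (ℤ.*-identityʳ (+ n)) m≤n)

floor-greatest : ∀ i p → fromℤ i ≤ p → i ℤ.≤ floor p
floor-greatest i (mkℚ n d _) (ℚ.*≤* i*d≤n) = ℤ.≤-trans (ℤ.i<j⇒i≤pred[j] i<1+f) (ℤ.≤-reflexive (ℤ.pred-suc f))
  where
  f = n ℤ./ + suc d
  n<[1+f]*d : n ℤ.< ℤ.suc f ℤ.* + suc d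
  n<[1+f]*d = subst (λ q → n ℤ.< ℤ.suc q ℤ.* + suc d) (sym (ℤ.div-pos-is-/ℕ n (suc d))) (ℤ.n<s[n/ℕd]*d n (suc d))
  i<1+f : i ℤ.< ℤ.suc f
  i<1+f = ℤ.*-cancelʳ-<-nonNeg (+ suc d) (ℤ.≤-<-trans (subst (i ℤ.* + suc d ℤ.≤_) (ℤ.*-identityʳ n) i*d≤n) n<[1+f]*d)

floor-least : ∀ i p → p ≤ fromℤ i → floor p ℤ.≤ i
floor-least i (mkℚ n d _) (ℚ.*≤* n≤i*d) =
  ℤ.*-cancelʳ-≤-pos _ i (+ suc d) (ℤ.≤-trans (ℤ.[n/d]*d≤n n (+ suc d)) (subst (ℤ._≤ i ℤ.* + suc d) (ℤ.*-identityʳ n) n≤i*d))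

neg-fromℤ : ∀ i → - fromℤ i ≡ fromℤ (ℤ.- i)
neg-fromℤ (+ zero)   = refl
neg-fromℤ (+ suc n)  = refl
neg-fromℤ ℤ.-[1+ n ] = refl

ceiling-least : ∀ i p → p ≤ fromℤ i → ceiling p ℤ.≤ i
ceiling-least i p@(mkℚ _ _ _) p≤i = subst (ceiling p ℤ.≤_) (ℤ.neg-involutive i) (ℤ.neg-mono-≤ -i≤⌊-p⌋)
  where
  -i≤⌊-p⌋ : ℤ.- i ℤ.≤ floor (- p)
  -i≤⌊-p⌋ = floor-greatest (ℤ.- i) (- p) (subst (_≤ - p) (neg-fromℤ i) (ℚ.neg-antimono-≤ p≤i))

ceiling-nonNeg : ∀ p → 0ℚ ≤ p → 0ℤ ℤ.≤ ceiling p
ceiling-nonNeg p@(mkℚ _ _ _) 0≤p = ℤ.neg-mono-≤ (floor-least 0ℤ (- p) (ℚ.neg-antimono-≤ 0≤p))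

∣ceiling∣≤ : ∀ k p → 0ℚ ≤ p → p ≤ fromℕ k → ℤ.∣ ceiling p ∣ ℕ.≤ k
∣ceiling∣≤ k p 0≤p p≤k = nonNeg-∣∣≤ (ceiling-nonNeg p 0≤p) (ceiling-least (+ k) p p≤k)
  where
  nonNeg-∣∣≤ : ∀ {i} → 0ℤ ℤ.≤ i → i ℤ.≤ + k → ℤ.∣ i ∣ ℕ.≤ k
  nonNeg-∣∣≤ _ (ℤ.+≤+ m≤k) = m≤k

*-mono-≤-nonNeg : ∀ {p q r s} → 0ℚ ≤ p → 0ℚ ≤ s → p ≤ q → r ≤ s → p * r ≤ q * s
*-mono-≤-nonNeg {p} {q} {r} {s} 0≤p 0≤s p≤q r≤s =
  ≤-trans (ℚ.*-monoˡ-≤-nonNeg p {{ℚ.nonNegative 0≤p}} r≤s) (ℚ.*-monoʳ-≤-nonNeg s {{ℚ.nonNegative 0≤s}} p≤q)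

*-nonNeg : ∀ {p q} → 0ℚ ≤ p → 0ℚ ≤ q → 0ℚ ≤ p * q
*-nonNeg {p} {q} 0≤p 0≤q = subst (_≤ p * q) (ℚ.*-zeroʳ p) (ℚ.*-monoˡ-≤-nonNeg p {{ℚ.nonNegative 0≤p}} 0≤q)

^ℚ-nonNeg : ∀ {q} n → 0ℚ ≤ q → 0ℚ ≤ q ^ℚ n
^ℚ-nonNeg zero    0≤q = ℚ.≤ᵇ⇒≤ _
^ℚ-nonNeg (suc n) 0≤q = *-nonNeg 0≤q (^ℚ-nonNeg n 0≤q)

^ℚ-monoˡ-≤ : ∀ {p q} n → 0ℚ ≤ p → p ≤ q → p ^ℚ n ≤ q ^ℚ n
^ℚ-monoˡ-≤ zero    0≤p p≤q = ≤-refl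
^ℚ-monoˡ-≤ (suc n) 0≤p p≤q =
  *-mono-≤-nonNeg 0≤p (^ℚ-nonNeg n (≤-trans 0≤p p≤q)) p≤q (^ℚ-monoˡ-≤ n 0≤p p≤q)

1^ℚ : ∀ n → 1ℚ ^ℚ n ≡ 1ℚ
1^ℚ n = trans (fromℕ-^ 1 n) (cong fromℕ (ℕ.^-zeroˡ n))

p≤r*q⇒p/ℚq≤r : ∀ p q r .{{_ : Positive q}} → p ≤ r * q → p /ℚ q ≤ r
p≤r*q⇒p/ℚq≤r p q r p≤r*q with q ℚ.≟ 0ℚ
... | yes refl = contradiction (ℚ.positive⁻¹ 0ℚ) (ℚ.<-irrefl refl)
... | no _ = begin
  p * q⁻¹         ≤⟨ ℚ.*-monoʳ-≤-nonNeg q⁻¹ {{ℚ.pos⇒nonNeg q⁻¹ {{ℚ.1/pos⇒pos q}}}} p≤r*q ⟩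
  r * q * q⁻¹     ≡⟨ ℚ.*-assoc r q q⁻¹ ⟩
  r * (q * q⁻¹)   ≡⟨ cong (r *_) (ℚ.*-inverseʳ q {{ℚ.pos⇒nonZero q}}) ⟩
  r * 1ℚ          ≡⟨ ℚ.*-identityʳ r ⟩
  r               ∎
  where
  open ℚ.≤-Reasoning
  q⁻¹ = (1/ q) {{ℚ.pos⇒nonZero q}}

/ℚ-nonNeg : ∀ p q .{{_ : Positive q}} → 0ℚ ≤ p → 0ℚ ≤ p /ℚ q
/ℚ-nonNeg p q 0≤p with q ℚ.≟ 0ℚ
... | yes refl = contradiction (ℚ.positive⁻¹ 0ℚ) (ℚ.<-irrefl refl)
... | no _ = *-nonNeg 0≤p (ℚ.nonNegative⁻¹ q⁻¹ {{ℚ.pos⇒nonNeg q⁻¹ {{ℚ.1/pos⇒pos q}}}})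
  where q⁻¹ = (1/ q) {{ℚ.pos⇒nonZero q}}

p≤p+q : ∀ {p q} → 0ℚ ≤ q → p ≤ p + q
p≤p+q {p} {q} 0≤q = subst (_≤ p + q) (ℚ.+-identityʳ p) (ℚ.+-monoʳ-≤ p 0≤q)

x-nonNeg : ∀ w → 0ℚ ≤ x w
x-nonNeg w = ^ℚ-nonNeg w (ℚ.≤ᵇ⇒≤ _)

0≤2+x : ∀ w → 0ℚ ≤ fromℕ 2 + x w
0≤2+x w = ≤-trans {j = fromℕ 2} (ℚ.≤ᵇ⇒≤ _) (p≤p+q (x-nonNeg w))

x≤1 : ∀ w → x w ≤ 1ℚ
x≤1 w = subst (x w ≤_) (1^ℚ w) (^ℚ-monoˡ-≤ w (ℚ.≤ᵇ⇒≤ _) (ℚ.≤ᵇ⇒≤ _))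

αsuc≤2^ : ∀ w p → αsuc w p ≤ fromℕ (2 ℕ.^ p)
αsuc≤2^ w p = begin
  (1ℚ /ℚ d) * (((fromℕ 2 + y) /ℚ d) ^ℚ p)
    ≤⟨ *-mono-≤-nonNeg (/ℚ-nonNeg 1ℚ d (ℚ.≤ᵇ⇒≤ _)) (^ℚ-nonNeg p (ℚ.≤ᵇ⇒≤ _)) 1/d≤1
                       (^ℚ-monoˡ-≤ p (/ℚ-nonNeg _ d (0≤2+x w)) [2+y]/d≤2) ⟩
  1ℚ * (fromℕ 2 ^ℚ p)  ≡⟨ ℚ.*-identityˡ _ ⟩
  fromℕ 2 ^ℚ p         ≡⟨ fromℕ-^ 2 p ⟩
  fromℕ (2 ℕ.^ p)      ∎
  where
  open ℚ.≤-Reasoning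
  y = x w
  d = 1ℚ + y
  instance
    d-pos : Positive d
    d-pos = ℚ.pos+nonNeg⇒pos 1ℚ y {{ℚ.nonNegative (x-nonNeg w)}}
  1/d≤1 : 1ℚ /ℚ d ≤ 1ℚ
  1/d≤1 = p≤r*q⇒p/ℚq≤r 1ℚ d 1ℚ (subst (1ℚ ≤_) (sym (ℚ.*-identityˡ d)) (p≤p+q (x-nonNeg w)))
  2*d≡2+y+y : fromℕ 2 * d ≡ fromℕ 2 + y + y
  2*d≡2+y+y = solve 1 (λ y → con (fromℕ 2) :* (con 1ℚ :+ y) := con (fromℕ 2) :+ y :+ y) refl y
    where open ℚ-Solver.+-*-Solver
  [2+y]/d≤2 : (fromℕ 2 + y) /ℚ d ≤ fromℕ 2
  [2+y]/d≤2 = p≤r*q⇒p/ℚq≤r (fromℕ 2 + y) d (fromℕ 2) (subst (fromℕ 2 + y ≤_) (sym 2*d≡2+y+y) (p≤p+q (x-nonNeg w)))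

1≤β : ∀ w → 1ℚ ≤ β w
1≤β w = ≤-trans (ℚ.≤ᵇ⇒≤ _) (ℚ.*-monoˡ-≤-nonNeg (fromℕ 3) 1≤[3/2]^w)
  where
  1≤[3/2]^w : 1ℚ ≤ ((+ 3) ℚ./ 2) ^ℚ w
  1≤[3/2]^w = subst (_≤ ((+ 3) ℚ./ 2) ^ℚ w) (1^ℚ w) (^ℚ-monoˡ-≤ w (ℚ.≤ᵇ⇒≤ _) (ℚ.≤ᵇ⇒≤ _))

β-nonNeg : ∀ w → 0ℚ ≤ β w
β-nonNeg w = ≤-trans (ℚ.≤ᵇ⇒≤ _) (1≤β w)

2β-suc : ∀ w → fromℕ 2 * β (suc w) ≡ fromℕ 2 * β w + β w
2β-suc w = solve 1 (λ t → con (fromℕ 2) :* (con (fromℕ 3) :* (con ((+ 3) ℚ./ 2) :* t))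
                        := con (fromℕ 2) :* (con (fromℕ 3) :* t) :+ con (fromℕ 3) :* t)
                   refl (((+ 3) ℚ./ 2) ^ℚ w)
  where open ℚ-Solver.+-*-Solver

1+w≤2β : ∀ w → fromℕ (suc w) ≤ fromℕ 2 * β w
1+w≤2β zero    = ℚ.≤ᵇ⇒≤ _
1+w≤2β (suc w) = begin
  fromℕ (1 ℕ.+ suc w)          ≡⟨ fromℕ-+ 1 (suc w) ⟩
  1ℚ + fromℕ (suc w)           ≤⟨ ℚ.+-mono-≤ (1≤β w) (1+w≤2β w) ⟩
  β w + fromℕ 2 * β w          ≡⟨ ℚ.+-comm (β w) _ ⟩
  fromℕ 2 * β w + β w          ≡⟨ 2β-suc w ⟨
  fromℕ 2 * β (suc w)          ∎
  where open ℚ.≤-Reasoning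

δ-nonNeg : ∀ w → 0ℚ ≤ δ w
δ-nonNeg w = *-nonNeg (0≤2+x w) (β-nonNeg w)

δ≤3β : ∀ w → δ w ≤ fromℕ 3 * β w
δ≤3β w = ℚ.*-monoʳ-≤-nonNeg (β w) {{ℚ.nonNegative (β-nonNeg w)}} (ℚ.+-monoʳ-≤ (fromℕ 2) (x≤1 w))

module _ (w pw : ℕ) (is-pw : IsPw w pw) where

  β≤2^pw : β w ≤ fromℕ (2 ℕ.^ pw)
  β≤2^pw = ≤-trans (proj₁ is-pw) (αsuc≤2^ w pw)

  ceilδ≤3*2^pw : ceilδ w ℕ.≤ 3 ℕ.* 2 ℕ.^ pw
  ceilδ≤3*2^pw = ∣ceiling∣≤ (3 ℕ.* 2 ℕ.^ pw) (δ w) (δ-nonNeg w) (begin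
    δ w                       ≤⟨ δ≤3β w ⟩
    fromℕ 3 * β w             ≤⟨ ℚ.*-monoˡ-≤-nonNeg (fromℕ 3) β≤2^pw ⟩
    fromℕ 3 * fromℕ (2 ℕ.^ pw) ≡⟨ fromℕ-* 3 (2 ℕ.^ pw) ⟨
    fromℕ (3 ℕ.* 2 ℕ.^ pw)     ∎)
    where open ℚ.≤-Reasoning

  1+w≤2*2^pw : suc w ℕ.≤ 2 ℕ.* 2 ℕ.^ pw
  1+w≤2*2^pw = fromℕ-cancel-≤ (begin
    fromℕ (suc w)              ≤⟨ 1+w≤2β w ⟩
    fromℕ 2 * β w              ≤⟨ ℚ.*-monoˡ-≤-nonNeg (fromℕ 2) β≤2^pw ⟩
    fromℕ 2 * fromℕ (2 ℕ.^ pw) ≡⟨ fromℕ-* 2 (2 ℕ.^ pw) ⟨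
    fromℕ (2 ℕ.* 2 ℕ.^ pw)     ∎)
    where open ℚ.≤-Reasoning

∣V∣-step : ∀ a H → ∣V∣ (step a H) ℕ.+ a ≡ 2 ℕ.* (∣V∣ H ℕ.+ a)
∣V∣-step a H = solve 2 (λ a h → (a :+ (h :+ h)) :+ a := con 2 :* (h :+ a)) refl a (∣V∣ H)
  where open ℕ-Solver.+-*-Solver

∣V∣-Gfrom : ∀ w k → ∣V∣ (Gfrom w k) ℕ.+ suc w ≡ 2 ℕ.^ k ℕ.* (ceilδ w ℕ.+ suc w)
∣V∣-Gfrom w zero    = sym (ℕ.*-identityˡ _)
∣V∣-Gfrom w (suc k) = begin
  ∣V∣ (step (suc w) (Gfrom w k)) ℕ.+ suc w  ≡⟨ ∣V∣-step (suc w) (Gfrom w k) ⟩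
  2 ℕ.* (∣V∣ (Gfrom w k) ℕ.+ suc w)        ≡⟨ cong (2 ℕ.*_) (∣V∣-Gfrom w k) ⟩
  2 ℕ.* (2 ℕ.^ k ℕ.* c)                    ≡⟨ ℕ.*-assoc 2 (2 ℕ.^ k) c ⟨
  2 ℕ.^ suc k ℕ.* c                        ∎
  where open ≡-Reasoning
        c = ceilδ w ℕ.+ suc w

lemma3p9 : Σ ℕ (λ W → (w : ℕ) → W ℕ.≤ w → (pw : ℕ) → IsPw w pw → (p : ℕ) → pw ℕ.≤ p → ∣V∣ (G w pw p) ℕ.≤ 5 ℕ.* 2 ℕ.^ p)
lemma3p9 = 0 , λ w _ pw is-pw p pw≤p → let k = p ℕ.∸ pw; B = 2 ℕ.^ pw in begin
  ∣V∣ (Gfrom w k)                    ≤⟨ ℕ.m≤m+n _ (suc w) ⟩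
  ∣V∣ (Gfrom w k) ℕ.+ suc w          ≡⟨ ∣V∣-Gfrom w k ⟩
  2 ℕ.^ k ℕ.* (ceilδ w ℕ.+ suc w)    ≤⟨ ℕ.*-monoʳ-≤ (2 ℕ.^ k) (ℕ.+-mono-≤ (ceilδ≤3*2^pw w pw is-pw) (1+w≤2*2^pw w pw is-pw)) ⟩
  2 ℕ.^ k ℕ.* (3 ℕ.* B ℕ.+ 2 ℕ.* B)  ≡⟨ solve 2 (λ u v → u :* (con 3 :* v :+ con 2 :* v) := con 5 :* (u :* v)) refl (2 ℕ.^ k) B ⟩
  5 ℕ.* (2 ℕ.^ k ℕ.* B)              ≡⟨ cong (5 ℕ.*_) (ℕ.^-distribˡ-+-* 2 k pw) ⟨
  5 ℕ.* 2 ℕ.^ (k ℕ.+ pw)             ≡⟨ cong (λ e → 5 ℕ.* 2 ℕ.^ e) (ℕ.m∸n+n≡m pw≤p) ⟩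
  5 ℕ.* 2 ℕ.^ p                      ∎
  where open ℕ.≤-Reasoning
        open ℕ-Solver.+-*-Solver
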